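{- Let $r,s,n$ be integers with $s\neq0$ and let $b$ be a positive integer. Then $$\delta_b(r,s,-n/b)=-\delta_b(r-s,-s,n/b).$$
   Context: For integers $r,s,b$ with $s\ne0$, $b\ge1$: set $\alpha:=r/s$, $c:=\gcd(r,s,b)$, $b':=b/c$, $s':=s/c$. For a positive integer $m$ and a rational $\alpha$ with reduced denominator coprime to $m$, $D_m(\alpha)$ is the unique rational with reduced denominator coprime to $m$ such that $mD_m(\alpha)-\alpha\in\{0,\dots,m-1\}$. Define $\delta_b(r,s,\cdot):\mathbb R\to\mathbb R$ by $\delta_b(r,s,x):=\lfloor cx-\gamma\rfloor+1$ with $\gamma:=D_{b'}(\alpha)+\lfloor1-\alpha\rfloor/b'$ if $\gcd(s',b')=1$, and $\delta_b(r,s,x):=0$ otherwise. -}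

module Defs where

open import Data.Nat as ℕ using (ℕ; zero; suc)
import Data.Nat.DivMod as ℕD
open import Data.Nat.GCD using (gcd)
open import Data.Nat.Coprimality using (coprime?)
open import Data.Integer as ℤ using (ℤ; +_; -[1+_]; ∣_∣)
open import Data.Rational as ℚ using (ℚ; ↧ₙ_; floor)
open import Relation.Nullary using (yes; no)

-- natural-number division, with the (never used) convention m / 0 = 0
divℕ : ℕ → ℕ → ℕ
divℕ m zero    = 0
divℕ m (suc k) = ℕD._/_ m (suc k)

-- the rational p / q for integers p, q (convention: p / 0 = 0, never used)
frac : ℤ → ℤ → ℚ
frac p (+ zero)    = ℚ.0ℚ
frac p (+ suc k)   = p ℚ./ suc k
frac p -[1+ k ]    = (ℤ.- p) ℚ./ suc k

cOf : ℤ → ℤ → ℕ → ℕ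
cOf r s b = gcd (gcd ∣ r ∣ ∣ s ∣) b

-- D_m(α): the rational d with reduced denominator coprime to m and
-- m d - α ∈ {0,…,m-1}.  Such d is of the form (α + k)/m with k ∈ {0,…,m-1};
-- we search k = 0,1,…,m-1 for the (unique, when it exists) one whose
-- reduced denominator is coprime to m.  (Fallback 0 if none; irrelevant when
-- the reduced denominator of α is coprime to m.)
Dsearch : ℕ → ℚ → ℕ → ℕ → ℚ
Dsearch m α k zero = ℚ.0ℚ
Dsearch m α k (suc fuel) with coprime? (↧ₙ d) m
  where d = (α ℚ.+ frac (+ k) (+ 1)) ℚ.* frac (+ 1) (+ m)
... | yes _ = (α ℚ.+ frac (+ k) (+ 1)) ℚ.* frac (+ 1) (+ m)
... | no  _ = Dsearch m α (suc k) fuel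

D : ℕ → ℚ → ℚ
D m α = Dsearch m α 0 m

δ : ℕ → ℤ → ℤ → ℚ → ℤ
δ b r s x with coprime? (divℕ ∣ s ∣ c) b'
  where c  = cOf r s b
        b' = divℕ b c
... | no  _ = + 0
... | yes _ = floor (frac (+ c) (+ 1) ℚ.* x ℚ.- γ) ℤ.+ + 1
  where
    c  = cOf r s b
    b' = divℕ b c
    α  = frac r s
    γ  = D b' α ℚ.+ frac (floor (ℚ.1ℚ ℚ.- α)) (+ b')

module Submission where

-- Put c = gcd(r, s, b), M = b / c and Q = |s| / c, and write α = r / s = P / Q; the other side has
-- the same c, M, Q and 1 - α = (Q - P) / Q.  When Q ⊥ M, D_M(α) = (α + k) / M for the k < M with
-- M ∣ P + kQ, and the corresponding index for 1 - α is k′ = M - 1 - k.  Over the common denominator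
-- MQ the fractional part of α is absorbed by ⌊1 - α⌋, so that ⌊c x - γ⌋ = ⌊(X - k - 1) / M⌋ for
-- c x = X / M, and the claim becomes ⌊(-1 - a) / M⌋ = -1 - ⌊a / M⌋.  Otherwise both sides are 0.

open import Defs
open import Data.Nat using (ℕ; _≤_)
open import Data.Integer using (ℤ; +_; -_; _-_)
open import Data.Rational using (ℚ)
open import Relation.Binary.PropositionalEquality using (_≡_; _≢_)

open import Data.Nat as ℕ using (zero; suc; z<s)
import Data.Nat.Properties as ℕ
import Data.Nat.DivMod as ℕ using (m/n*n≡m)
import Data.Nat.Divisibility as ℕ
open import Data.Nat.Coprimality as Coprime using (Coprime; coprime?; coprime-divisor)
open import Data.Nat.GCD using (gcd; gcd[m,n]∣m; gcd[m,n]∣n; gcd-greatest; module Bézout)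
open import Data.Integer using (-[1+_]; ∣_∣; _+_; _*_; _/ℕ_; _%ℕ_; 0ℤ; 1ℤ; -1ℤ)
import Data.Integer as ℤ
import Data.Integer.Properties as ℤ
open import Data.Integer.DivMod using (a≡a%ℕn+[a/ℕn]*n; n%ℕd<d; [n/ℕd]*d≤n; n<s[n/ℕd]*d; div-pos-is-/ℕ)
open import Data.Integer.Divisibility.Signed as ℤ using (_∣_; ∣ᵤ⇒∣; ∣⇒∣ᵤ)
open import Data.Integer.Tactic.RingSolver using (solve-∀)
open import Data.Rational using (mkℚ; floor; toℚᵘ; ↧ₙ_)
import Data.Rational as ℚ
import Data.Rational.Properties as ℚ
open import Data.Rational.Unnormalised as ℚᵘ using (*≡*)
import Data.Rational.Unnormalised.Properties as ℚᵘ
open import Data.Product using (∃-syntax; _×_; _,_)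
open import Data.Sum using (inj₁; inj₂)
open import Data.Empty using (⊥-elim)
open import Function using (_∘_; case_of_)
open import Relation.Nullary using (¬_; yes; no)
open import Relation.Binary.PropositionalEquality using (refl; sym; trans; cong; cong₂; subst; module ≡-Reasoning)

-- Integer division by a positive natural

i<suc[j]⇒i≤j : ∀ {i j} → i ℤ.< ℤ.suc j → i ℤ.≤ j
i<suc[j]⇒i≤j {i} {j} i<1+j = subst (i ℤ.≤_) (ℤ.pred-suc j) (ℤ.i<j⇒i≤pred[j] i<1+j)

/ℕ-unique : ∀ d .{{_ : ℕ.NonZero d}} {n} q r → r ℕ.< d → n ≡ + r + q * + d → n /ℕ d ≡ q
/ℕ-unique d {n} q r r<d refl = ℤ.≤-antisym
  (i<suc[j]⇒i≤j (ℤ.*-cancelʳ-<-nonNeg (+ d) (ℤ.≤-<-trans ([n/ℕd]*d≤n n d) n<[1+q]*d)))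
  (i<suc[j]⇒i≤j (ℤ.*-cancelʳ-<-nonNeg (+ d) (ℤ.≤-<-trans (ℤ.i≤j+i (q * + d) (+ r)) (n<s[n/ℕd]*d n d))))
  where
  open ℤ.≤-Reasoning
  n<[1+q]*d : + r + q * + d ℤ.< ℤ.suc q * + d
  n<[1+q]*d = begin-strict
    + r + q * + d  <⟨ ℤ.+-monoˡ-< (q * + d) (ℤ.+<+ r<d) ⟩
    + d + q * + d  ≡⟨ ℤ.suc-* q (+ d) ⟨
    ℤ.suc q * + d  ∎

/ℕ-congʳ : ∀ n {d e} .{{_ : ℕ.NonZero d}} .{{_ : ℕ.NonZero e}} → d ≡ e → n /ℕ d ≡ n /ℕ e
/ℕ-congʳ n refl = refl

r*q+t<m*q : ∀ {r t m q} → r ℕ.< m → t ℕ.< q → r ℕ.* q ℕ.+ t ℕ.< m ℕ.* q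
r*q+t<m*q {r} {t} {m} {q} r<m t<q = begin-strict
  r ℕ.* q ℕ.+ t  <⟨ ℕ.+-monoʳ-< (r ℕ.* q) t<q ⟩
  r ℕ.* q ℕ.+ q  ≡⟨ ℕ.+-comm (r ℕ.* q) q ⟩
  suc r ℕ.* q    ≤⟨ ℕ.*-monoˡ-≤ q r<m ⟩
  m ℕ.* q        ∎
  where open ℕ.≤-Reasoning

[a*q+t]/ℕ[m*q]≡a/ℕm : ∀ m q .{{_ : ℕ.NonZero m}} .{{_ : ℕ.NonZero (m ℕ.* q)}} a t → t ℕ.< q →
                       (a * + q + + t) /ℕ (m ℕ.* q) ≡ a /ℕ m
[a*q+t]/ℕ[m*q]≡a/ℕm m q a t t<q =
  /ℕ-unique (m ℕ.* q) (a /ℕ m) _ (r*q+t<m*q (n%ℕd<d a m) t<q) (begin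
    a * + q + + t                           ≡⟨ cong (λ x → x * + q + + t) (a≡a%ℕn+[a/ℕn]*n a m) ⟩
    (+ r + a /ℕ m * + m) * + q + + t        ≡⟨ ring (+ r) (a /ℕ m) (+ m) (+ q) (+ t) ⟩
    + r * + q + + t + a /ℕ m * (+ m * + q)  ≡⟨ cong₂ (λ x y → x + + t + a /ℕ m * y) (ℤ.pos-* r q) (ℤ.pos-* m q) ⟨
    + (r ℕ.* q) + + t + a /ℕ m * + (m ℕ.* q) ≡⟨ cong (_+ a /ℕ m * + (m ℕ.* q)) (ℤ.pos-+ (r ℕ.* q) t) ⟨
    + (r ℕ.* q ℕ.+ t) + a /ℕ m * + (m ℕ.* q) ∎)
  where
  open ≡-Reasoning
  r = a %ℕ m
  ring : ∀ r k m q t → (r + k * m) * q + t ≡ r * q + t + k * (m * q)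
  ring = solve-∀

[a-d]/ℕd≡a/ℕd-1 : ∀ d .{{_ : ℕ.NonZero d}} a → (a - + d) /ℕ d ≡ a /ℕ d - 1ℤ
[a-d]/ℕd≡a/ℕd-1 d a = /ℕ-unique d (a /ℕ d - 1ℤ) (a %ℕ d) (n%ℕd<d a d) (begin
  a - + d                              ≡⟨ cong (_- + d) (a≡a%ℕn+[a/ℕn]*n a d) ⟩
  + (a %ℕ d) + a /ℕ d * + d - + d      ≡⟨ ring (+ (a %ℕ d)) (a /ℕ d) (+ d) ⟩
  + (a %ℕ d) + (a /ℕ d - 1ℤ) * + d     ∎)
  where
  open ≡-Reasoning
  ring : ∀ r q d → r + q * d - d ≡ r + (q - 1ℤ) * d
  ring = solve-∀

[-1-a]/ℕd≡-1-a/ℕd : ∀ d .{{_ : ℕ.NonZero d}} a → (-1ℤ - a) /ℕ d ≡ -1ℤ - a /ℕ d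
[-1-a]/ℕd≡-1-a/ℕd d a = /ℕ-unique d (-1ℤ - a /ℕ d) (d ℕ.∸ suc r) (ℕ.∸-monoʳ-< z<s r<d) (begin
  -1ℤ - a                                  ≡⟨ cong (λ x → -1ℤ - x) (a≡a%ℕn+[a/ℕn]*n a d) ⟩
  -1ℤ - (+ r + a /ℕ d * + d)               ≡⟨ ring (+ r) (a /ℕ d) (+ d) ⟩
  (+ d - + suc r) + (-1ℤ - a /ℕ d) * + d   ≡⟨ cong (_+ (-1ℤ - a /ℕ d) * + d) d-[1+r]≡d∸[1+r] ⟩
  + (d ℕ.∸ suc r) + (-1ℤ - a /ℕ d) * + d   ∎)
  where
  open ≡-Reasoning
  r = a %ℕ d
  r<d = n%ℕd<d a d
  d-[1+r]≡d∸[1+r] : + d - + suc r ≡ + (d ℕ.∸ suc r)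
  d-[1+r]≡d∸[1+r] = trans (ℤ.m-n≡m⊖n d (suc r)) (ℤ.⊖-≥ r<d)
  ring : ∀ r q d → -1ℤ - (r + q * d) ≡ (d - (1ℤ + r)) + (-1ℤ - q) * d
  ring = solve-∀

m∣1+n∧1+n<m+m⇒1+n≡m : ∀ {m n} → m ℕ.∣ suc n → suc n ℕ.< m ℕ.+ m → suc n ≡ m
m∣1+n∧1+n<m+m⇒1+n≡m {m} (ℕ.divides (suc zero) 1+n≡1*m) _ = trans 1+n≡1*m (ℕ.+-identityʳ m)
m∣1+n∧1+n<m+m⇒1+n≡m {m} (ℕ.divides (suc (suc q)) 1+n≡[2+q]*m) 1+n<m+m =
  ⊥-elim (ℕ.<⇒≱ 1+n<m+m (begin
    m ℕ.+ m                      ≤⟨ ℕ.+-monoʳ-≤ m (ℕ.m≤m+n m (q ℕ.* m)) ⟩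
    m ℕ.+ (m ℕ.+ q ℕ.* m)        ≡⟨ 1+n≡[2+q]*m ⟨
    _                            ∎))
  where open ℕ.≤-Reasoning

-- Rationals presented by an unreduced fraction

floor≡/ℕ : ∀ p {N d} .{{_ : ℕ.NonZero d}} → toℚᵘ p ℚᵘ.≃ N ℚᵘ./ d → floor p ≡ N /ℕ d
floor≡/ℕ p@(mkℚ n e-1 _) {N} {d@(suc _)} (*≡* n*d≡N*e) = begin
  floor p                      ≡⟨ div-pos-is-/ℕ n e ⟩
  n /ℕ e                       ≡⟨ [a*q+t]/ℕ[m*q]≡a/ℕm e d n 0 z<s ⟨
  (n * + d + + 0) /ℕ (e ℕ.* d) ≡⟨ cong (λ x → (x + + 0) /ℕ (e ℕ.* d)) n*d≡N*e ⟩
  (N * + e + + 0) /ℕ (e ℕ.* d) ≡⟨ /ℕ-congʳ (N * + e + + 0) (ℕ.*-comm e d) ⟩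
  (N * + e + + 0) /ℕ (d ℕ.* e) ≡⟨ [a*q+t]/ℕ[m*q]≡a/ℕm d e N 0 z<s ⟩
  N /ℕ d                       ∎
  where
  open ≡-Reasoning
  e = suc e-1

∣↥∣*d≡∣N∣*↧ₙ : ∀ p {N d} .{{_ : ℕ.NonZero d}} → toℚᵘ p ℚᵘ.≃ N ℚᵘ./ d →
               ∣ ℚ.↥ p ∣ ℕ.* d ≡ ∣ N ∣ ℕ.* ↧ₙ p
∣↥∣*d≡∣N∣*↧ₙ (mkℚ n e-1 _) {N} {suc d-1} (*≡* n*d≡N*e) = begin
  ∣ n ∣ ℕ.* suc d-1    ≡⟨ ℤ.abs-* n (+ suc d-1) ⟨
  ∣ n * + suc d-1 ∣    ≡⟨ cong ∣_∣ n*d≡N*e ⟩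
  ∣ N * + suc e-1 ∣    ≡⟨ ℤ.abs-* N (+ suc e-1) ⟩
  ∣ N ∣ ℕ.* suc e-1    ∎
  where open ≡-Reasoning

↧ₙ∣d : ∀ p {N d} .{{_ : ℕ.NonZero d}} → toℚᵘ p ℚᵘ.≃ N ℚᵘ./ d → ↧ₙ p ℕ.∣ d
↧ₙ∣d p@(mkℚ _ _ n⊥e) {N} p≃N/d = coprime-divisor (Coprime.sym (Coprime.recompute n⊥e))
  (ℕ.divides ∣ N ∣ (∣↥∣*d≡∣N∣*↧ₙ p p≃N/d))

coprime-↧ₙ⇒∣N : ∀ p {N d m} .{{_ : ℕ.NonZero d}} → toℚᵘ p ℚᵘ.≃ N ℚᵘ./ d →
                m ℕ.∣ d → Coprime (↧ₙ p) m → m ℕ.∣ ∣ N ∣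
coprime-↧ₙ⇒∣N p {N} {d} {m} p≃N/d m∣d e⊥m = coprime-divisor (Coprime.sym e⊥m)
  (subst (m ℕ.∣_) (trans (∣↥∣*d≡∣N∣*↧ₙ p p≃N/d) (ℕ.*-comm ∣ N ∣ (↧ₙ p)))
                  (ℕ.∣n⇒∣m*n ∣ ℚ.↥ p ∣ m∣d))

toℚᵘ-frac : ∀ i d .{{_ : ℕ.NonZero d}} → toℚᵘ (frac i (+ d)) ℚᵘ.≃ i ℚᵘ./ d
toℚᵘ-frac i (suc d-1) = ℚ.toℚᵘ-fromℚᵘ (i ℚᵘ./ suc d-1)

toℚᵘ-neg-frac : ∀ n b .{{_ : ℕ.NonZero b}} → toℚᵘ (ℚ.- frac n (+ b)) ℚᵘ.≃ (- n) ℚᵘ./ b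
toℚᵘ-neg-frac n b@(suc _) = ℚᵘ.≃-trans (ℚ.toℚᵘ-homo‿- (frac n (+ b))) (ℚᵘ.-‿cong (toℚᵘ-frac n b))

toℚᵘ-homo-minus : ∀ p q → toℚᵘ (p ℚ.- q) ℚᵘ.≃ toℚᵘ p ℚᵘ.- toℚᵘ q
toℚᵘ-homo-minus p q = ℚᵘ.≃-trans (ℚ.toℚᵘ-homo-+ p (ℚ.- q)) (ℚᵘ.+-congʳ (toℚᵘ p) (ℚ.toℚᵘ-homo‿- q))

≃-rescale : ∀ {p N P d e} .{{_ : ℕ.NonZero d}} .{{_ : ℕ.NonZero e}} →
            toℚᵘ p ℚᵘ.≃ N ℚᵘ./ d → N * + e ≡ P * + d → toℚᵘ p ℚᵘ.≃ P ℚᵘ./ e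
≃-rescale {d = suc _} {suc _} p≃N/d Ne≡Pd = ℚᵘ.≃-trans p≃N/d (*≡* Ne≡Pd)

toℚᵘ[1-α] : ∀ {α P Q} .{{_ : ℕ.NonZero Q}} → toℚᵘ α ℚᵘ.≃ P ℚᵘ./ Q →
            toℚᵘ (ℚ.1ℚ ℚ.- α) ℚᵘ.≃ (+ Q - P) ℚᵘ./ Q
toℚᵘ[1-α] {α} {P} {Q@(suc _)} α≃P/Q = begin
  toℚᵘ (ℚ.1ℚ ℚ.- α)              ≈⟨ toℚᵘ-homo-minus ℚ.1ℚ α ⟩
  ℚᵘ.1ℚᵘ ℚᵘ.- toℚᵘ α             ≈⟨ ℚᵘ.+-congʳ ℚᵘ.1ℚᵘ (ℚᵘ.-‿cong α≃P/Q) ⟩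
  ℚᵘ.1ℚᵘ ℚᵘ.- P ℚᵘ./ Q           ≈⟨ difference ⟩
  (+ Q - P) ℚᵘ./ Q               ∎
  where
  open ℚᵘ.≃-Reasoning
  ring : ∀ p q → (1ℤ * q + - p * 1ℤ) * q ≡ (q - p) * (1ℤ * q)
  ring = solve-∀
  difference : ℚᵘ.1ℚᵘ ℚᵘ.- P ℚᵘ./ Q ℚᵘ.≃ (+ Q - P) ℚᵘ./ Q
  difference = *≡* (ring P (+ Q))

toℚᵘ-c*x : ∀ {x N b c M} .{{_ : ℕ.NonZero b}} .{{_ : ℕ.NonZero M}} → b ≡ M ℕ.* c →
            toℚᵘ x ℚᵘ.≃ N ℚᵘ./ b → toℚᵘ (frac (+ c) (+ 1) ℚ.* x) ℚᵘ.≃ N ℚᵘ./ M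
toℚᵘ-c*x {x} {N} {b@(suc _)} {c} {M@(suc _)} b≡Mc x≃N/b =
  ℚᵘ.≃-trans (ℚ.toℚᵘ-homo-* (frac (+ c) (+ 1)) x) (ℚᵘ.≃-trans (ℚᵘ.*-cong (toℚᵘ-frac (+ c) 1) x≃N/b) (*≡* (begin
    + c * N * + M          ≡⟨ ring (+ c) N (+ M) ⟩
    N * (+ M * + c)        ≡⟨ cong (N *_) (ℤ.pos-* M c) ⟨
    N * + (M ℕ.* c)        ≡⟨ cong (λ a → N * + a) b≡Mc ⟨
    N * + b                ≡⟨ cong (λ a → N * + a) (ℕ.*-identityˡ b) ⟨
    N * + (1 ℕ.* b)        ∎)))
  where
  open ≡-Reasoning
  ring : ∀ c n m → c * n * m ≡ n * (m * c)
  ring = solve-∀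

-- The value D_M(α)

-- The k-th value tried by Dsearch, spelled exactly as in its definition so that Dsearch reduces
-- once coprime? is abstracted.
candidate : ℕ → ℚ → ℕ → ℚ
candidate m α k = (α ℚ.+ frac (+ k) (+ 1)) ℚ.* frac (+ 1) (+ m)

candidate-≃ : ∀ {α P Q} M k .{{_ : ℕ.NonZero Q}} .{{_ : ℕ.NonZero (M ℕ.* Q)}} → toℚᵘ α ℚᵘ.≃ P ℚᵘ./ Q →
              toℚᵘ (candidate M α k) ℚᵘ.≃ (P + + k * + Q) ℚᵘ./ (M ℕ.* Q)
candidate-≃ {α} {P} {Q@(suc _)} M@(suc _) k α≃P/Q = begin
  toℚᵘ (candidate M α k)                                   ≈⟨ ℚ.toℚᵘ-homo-* (α ℚ.+ frac (+ k) (+ 1)) (frac 1ℤ (+ M)) ⟩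
  toℚᵘ (α ℚ.+ frac (+ k) (+ 1)) ℚᵘ.* toℚᵘ (frac 1ℤ (+ M))  ≈⟨ ℚᵘ.*-cong (ℚᵘ.≃-trans (ℚ.toℚᵘ-homo-+ α (frac (+ k) (+ 1)))
                                                              (ℚᵘ.+-cong α≃P/Q (toℚᵘ-frac (+ k) 1)))
                                                              (toℚᵘ-frac 1ℤ M) ⟩
  (P ℚᵘ./ Q ℚᵘ.+ + k ℚᵘ./ 1) ℚᵘ.* (1ℤ ℚᵘ./ M)               ≈⟨ sum ⟩
  (P + + k * + Q) ℚᵘ./ (M ℕ.* Q)                            ∎
  where
  open ℚᵘ.≃-Reasoning
  ring : ∀ p k q m → (p * 1ℤ + k * q) * 1ℤ * (m * q) ≡ (p + k * q) * (q * 1ℤ * m)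
  ring = solve-∀
  sum : (P ℚᵘ./ Q ℚᵘ.+ + k ℚᵘ./ 1) ℚᵘ.* (1ℤ ℚᵘ./ M) ℚᵘ.≃ (P + + k * + Q) ℚᵘ./ (M ℕ.* Q)
  sum = *≡* (ring P (+ k) (+ Q) (+ M))

candidate-coprime⇒∣ : ∀ {α P Q} M k .{{_ : ℕ.NonZero Q}} .{{_ : ℕ.NonZero (M ℕ.* Q)}} →
                      toℚᵘ α ℚᵘ.≃ P ℚᵘ./ Q → Coprime (↧ₙ (candidate M α k)) M → + M ∣ P + + k * + Q
candidate-coprime⇒∣ {α} {Q = Q} M k α≃P/Q cop =
  ∣ᵤ⇒∣ (coprime-↧ₙ⇒∣N (candidate M α k) (candidate-≃ M k α≃P/Q) (ℕ.m∣m*n Q) cop)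

∣⇒candidate-coprime : ∀ {α P Q} M k .{{_ : ℕ.NonZero Q}} .{{_ : ℕ.NonZero (M ℕ.* Q)}} →
                      toℚᵘ α ℚᵘ.≃ P ℚᵘ./ Q → Coprime Q M → + M ∣ P + + k * + Q →
                      Coprime (↧ₙ (candidate M α k)) M
∣⇒candidate-coprime {α} {P} {Q@(suc _)} M@(suc _) k α≃P/Q Q⊥M (ℤ.divides w P+kQ≡wM) (i∣den , i∣M) =
  Q⊥M (ℕ.∣-trans i∣den (↧ₙ∣d (candidate M α k) candidate≃w/Q) , i∣M)
  where
  candidate≃w/Q : toℚᵘ (candidate M α k) ℚᵘ.≃ w ℚᵘ./ Q
  candidate≃w/Q = ℚᵘ.≃-trans (candidate-≃ M k α≃P/Q) (*≡* (begin
    (P + + k * + Q) * + Q    ≡⟨ cong (_* + Q) P+kQ≡wM ⟩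
    w * + M * + Q            ≡⟨ ℤ.*-assoc w (+ M) (+ Q) ⟩
    w * (+ M * + Q)          ∎))
    where open ≡-Reasoning

Dsearch-coprime : ∀ m α fuel k {k₀} → k ℕ.≤ k₀ → k₀ ℕ.< k ℕ.+ fuel → Coprime (↧ₙ (candidate m α k₀)) m →
                  ∃[ j ] j ℕ.< k ℕ.+ fuel × Coprime (↧ₙ (candidate m α j)) m × Dsearch m α k fuel ≡ candidate m α j
Dsearch-coprime m α zero k k≤k₀ k₀<k+0 _ =
  ⊥-elim (ℕ.<⇒≱ (subst (_ ℕ.<_) (ℕ.+-identityʳ k) k₀<k+0) k≤k₀)
Dsearch-coprime m α (suc fuel) k {k₀} k≤k₀ k₀<k+1+fuel k₀-cop with coprime? (↧ₙ (candidate m α k)) m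
... | yes k-cop = k , ℕ.m<m+n k z<s , k-cop , refl
... | no ¬k-cop with ℕ.m≤n⇒m<n∨m≡n k≤k₀
...   | inj₂ refl = ⊥-elim (¬k-cop k₀-cop)
...   | inj₁ k<k₀ with Dsearch-coprime m α fuel (suc k) k<k₀ (subst (k₀ ℕ.<_) (ℕ.+-suc k fuel) k₀<k+1+fuel) k₀-cop
...     | j , j<1+k+fuel , j-cop , search≡ = j , subst (j ℕ.<_) (sym (ℕ.+-suc k fuel)) j<1+k+fuel , j-cop , search≡

coprime⇒∃inverse : ∀ {Q M} → Coprime Q M → ∃[ u ] + M ∣ u * + Q - 1ℤ
coprime⇒∃inverse {Q} {M} Q⊥M with Coprime.coprime-Bézout Q⊥M
... | Bézout.+- x y 1+yM≡xQ = + x , ℤ.divides (+ y) (begin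
  + x * + Q - 1ℤ         ≡⟨ cong (_- 1ℤ) (ℤ.pos-* x Q) ⟨
  + (x ℕ.* Q) - 1ℤ       ≡⟨ cong (λ n → + n - 1ℤ) 1+yM≡xQ ⟨
  1ℤ + + (y ℕ.* M) - 1ℤ  ≡⟨ ring (+ (y ℕ.* M)) ⟩
  + (y ℕ.* M)            ≡⟨ ℤ.pos-* y M ⟩
  + y * + M              ∎)
  where
  open ≡-Reasoning
  ring : ∀ a → 1ℤ + a - 1ℤ ≡ a
  ring = solve-∀
... | Bézout.-+ x y 1+xQ≡yM = - + x , ℤ.divides (- + y) (begin
  - + x * + Q - 1ℤ       ≡⟨ ring (+ x) (+ Q) ⟩
  - (1ℤ + + x * + Q)     ≡⟨ cong (λ n → - (1ℤ + n)) (ℤ.pos-* x Q) ⟨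
  - + (1 ℕ.+ x ℕ.* Q)    ≡⟨ cong (λ n → - + n) 1+xQ≡yM ⟩
  - + (y ℕ.* M)          ≡⟨ cong -_ (ℤ.pos-* y M) ⟩
  - (+ y * + M)          ≡⟨ ℤ.neg-distribˡ-* (+ y) (+ M) ⟩
  - + y * + M            ∎)
  where
  open ≡-Reasoning
  ring : ∀ x q → - x * q - 1ℤ ≡ - (1ℤ + x * q)
  ring = solve-∀

coprime⇒∃k,M∣P+kQ : ∀ {Q M} .{{_ : ℕ.NonZero M}} P → Coprime Q M → ∃[ k ] k ℕ.< M × + M ∣ P + + k * + Q
coprime⇒∃k,M∣P+kQ {Q} {M} P Q⊥M with coprime⇒∃inverse Q⊥M
... | u , M∣uQ-1 = z %ℕ M , n%ℕd<d z M , subst (+ M ∣_) P-P[uQ-1]-qQM≡P+kQ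
  (ℤ.∣m∣n⇒∣m-n (ℤ.∣n⇒∣m*n (- P) M∣uQ-1) (ℤ.∣n⇒∣m*n (z /ℕ M * + Q) ℤ.∣-refl))
  where
  open ≡-Reasoning
  z = - P * u
  ring₁ : ∀ p u q m r → - p * (u * q - 1ℤ) - r * q * m ≡ p + - p * u * q - r * q * m
  ring₁ = solve-∀
  ring₂ : ∀ p k r m q → p + (k + r * m) * q - r * q * m ≡ p + k * q
  ring₂ = solve-∀
  P-P[uQ-1]-qQM≡P+kQ : - P * (u * + Q - 1ℤ) - z /ℕ M * + Q * + M ≡ P + + (z %ℕ M) * + Q
  P-P[uQ-1]-qQM≡P+kQ = begin
    - P * (u * + Q - 1ℤ) - z /ℕ M * + Q * + M              ≡⟨ ring₁ P u (+ Q) (+ M) (z /ℕ M) ⟩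
    P + z * + Q - z /ℕ M * + Q * + M                        ≡⟨ cong (λ x → P + x * + Q - z /ℕ M * + Q * + M)
                                                                    (a≡a%ℕn+[a/ℕn]*n z M) ⟩
    P + (+ (z %ℕ M) + z /ℕ M * + M) * + Q - z /ℕ M * + Q * + M ≡⟨ ring₂ P (+ (z %ℕ M)) (z /ℕ M) (+ M) (+ Q) ⟩
    P + + (z %ℕ M) * + Q                                    ∎

D≡candidate : ∀ {α P Q} M .{{_ : ℕ.NonZero Q}} .{{_ : ℕ.NonZero M}} .{{_ : ℕ.NonZero (M ℕ.* Q)}} →
              toℚᵘ α ℚᵘ.≃ P ℚᵘ./ Q → Coprime Q M →
              ∃[ k ] k ℕ.< M × + M ∣ P + + k * + Q × D M α ≡ candidate M α k
D≡candidate {α} {P} M α≃P/Q Q⊥M =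
  let k₀ , k₀<M , M∣P+k₀Q = coprime⇒∃k,M∣P+kQ P Q⊥M
      k , k<M , k-cop , D≡ = Dsearch-coprime M α M 0 ℕ.z≤n k₀<M (∣⇒candidate-coprime M k₀ α≃P/Q Q⊥M M∣P+k₀Q)
  in k , k<M , candidate-coprime⇒∣ M k α≃P/Q k-cop , D≡

M∣P+kQ∧M∣Q-P+k′Q⇒1+k+k′≡M : ∀ {P Q M k k′} → k ℕ.< M → k′ ℕ.< M → Coprime Q M →
            + M ∣ P + + k * + Q → + M ∣ (+ Q - P) + + k′ * + Q → suc (k ℕ.+ k′) ≡ M
M∣P+kQ∧M∣Q-P+k′Q⇒1+k+k′≡M {P} {Q} {M} {k} {k′} k<M k′<M Q⊥M M∣P+kQ M∣Q-P+k′Q =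
  m∣1+n∧1+n<m+m⇒1+n≡m (coprime-divisor (Coprime.sym Q⊥M) M∣Q[1+k+k′]) (ℕ.+-mono-≤-< k<M k′<M)
  where
  open ≡-Reasoning
  ring : ∀ p q k k′ → p + k * q + ((q - p) + k′ * q) ≡ q * (1ℤ + (k + k′))
  ring = solve-∀
  sum≡ : P + + k * + Q + ((+ Q - P) + + k′ * + Q) ≡ + (Q ℕ.* suc (k ℕ.+ k′))
  sum≡ = begin
    P + + k * + Q + ((+ Q - P) + + k′ * + Q) ≡⟨ ring P (+ Q) (+ k) (+ k′) ⟩
    + Q * (1ℤ + (+ k + + k′))                ≡⟨ cong (λ x → + Q * (1ℤ + x)) (ℤ.pos-+ k k′) ⟨
    + Q * + suc (k ℕ.+ k′)                   ≡⟨ ℤ.pos-* Q (suc (k ℕ.+ k′)) ⟨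
    + (Q ℕ.* suc (k ℕ.+ k′))                 ∎
  M∣Q[1+k+k′] : M ℕ.∣ Q ℕ.* suc (k ℕ.+ k′)
  M∣Q[1+k+k′] = ∣⇒∣ᵤ (subst (+ M ∣_) sum≡ (ℤ.∣m∣n⇒∣m+n M∣P+kQ M∣Q-P+k′Q))

-- The shift γ and the reflection identity

γ : ℕ → ℚ → ℚ
γ M α = D M α ℚ.+ frac (floor (ℚ.1ℚ ℚ.- α)) (+ M)

toℚᵘ[y-[D+f/M]] : ∀ {α y P Q X f} M k .{{_ : ℕ.NonZero Q}} .{{_ : ℕ.NonZero M}} .{{_ : ℕ.NonZero (M ℕ.* Q)}} →
                  toℚᵘ α ℚᵘ.≃ P ℚᵘ./ Q → D M α ≡ candidate M α k → toℚᵘ y ℚᵘ.≃ X ℚᵘ./ M →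
                  toℚᵘ (y ℚ.- (D M α ℚ.+ frac f (+ M)))
                    ℚᵘ.≃ (X * + Q - (P + + k * + Q) - f * + Q) ℚᵘ./ (M ℕ.* Q)
toℚᵘ[y-[D+f/M]] {α} {y} {P} {Q@(suc _)} {X} {f} M@(suc _) k α≃P/Q D≡ y≃X/M = begin
  toℚᵘ (y ℚ.- (D M α ℚ.+ frac f (+ M)))                      ≈⟨ toℚᵘ-homo-minus y _ ⟩
  toℚᵘ y ℚᵘ.- toℚᵘ (D M α ℚ.+ frac f (+ M))                  ≈⟨ ℚᵘ.+-cong y≃X/M (ℚᵘ.-‿cong (ℚᵘ.≃-trans
                                                                  (ℚ.toℚᵘ-homo-+ (D M α) (frac f (+ M)))
                                                                  (ℚᵘ.+-cong D≃ (toℚᵘ-frac f M)))) ⟩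
  X ℚᵘ./ M ℚᵘ.- (N ℚᵘ./ (M ℕ.* Q) ℚᵘ.+ f ℚᵘ./ M)             ≈⟨ difference ⟩
  (X * + Q - N - f * + Q) ℚᵘ./ (M ℕ.* Q)                     ∎
  where
  open ℚᵘ.≃-Reasoning
  N = P + + k * + Q
  D≃ : toℚᵘ (D M α) ℚᵘ.≃ N ℚᵘ./ (M ℕ.* Q)
  D≃ = subst (λ d → toℚᵘ d ℚᵘ.≃ N ℚᵘ./ (M ℕ.* Q)) (sym D≡) (candidate-≃ M k α≃P/Q)
  ring : ∀ x n f m q → (x * (m * q * m) + - (n * m + f * (m * q)) * m) * (m * q)
                     ≡ (x * q - n - f * q) * (m * (m * q * m))
  ring = solve-∀
  difference : X ℚᵘ./ M ℚᵘ.- (N ℚᵘ./ (M ℕ.* Q) ℚᵘ.+ f ℚᵘ./ M) ℚᵘ.≃ (X * + Q - N - f * + Q) ℚᵘ./ (M ℕ.* Q)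
  difference = *≡* (ring X N f (+ M) (+ Q))

floor[y-γ] : ∀ {α y P Q X} M k .{{_ : ℕ.NonZero Q}} .{{_ : ℕ.NonZero M}} .{{_ : ℕ.NonZero (M ℕ.* Q)}} →
             toℚᵘ α ℚᵘ.≃ P ℚᵘ./ Q → D M α ≡ candidate M α k → toℚᵘ y ℚᵘ.≃ X ℚᵘ./ M →
             floor (y ℚ.- γ M α) ≡ (X - + k - 1ℤ) /ℕ M
floor[y-γ] {α} {y} {P} {Q} {X} M k α≃P/Q D≡ y≃X/M = begin
  floor (y ℚ.- γ M α)                                        ≡⟨ floor≡/ℕ _ (toℚᵘ[y-[D+f/M]] M k α≃P/Q D≡ y≃X/M) ⟩
  (X * + Q - (P + + k * + Q) - f * + Q) /ℕ (M ℕ.* Q)         ≡⟨ cong (_/ℕ (M ℕ.* Q)) numerator≡ ⟩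
  ((X - + k - 1ℤ) * + Q + + t) /ℕ (M ℕ.* Q)                  ≡⟨ [a*q+t]/ℕ[m*q]≡a/ℕm M Q (X - + k - 1ℤ) t t<Q ⟩
  (X - + k - 1ℤ) /ℕ M                                        ∎
  where
  open ≡-Reasoning
  f = floor (ℚ.1ℚ ℚ.- α)
  t = (+ Q - P) %ℕ Q
  t<Q = n%ℕd<d (+ Q - P) Q
  f≡ : f ≡ (+ Q - P) /ℕ Q
  f≡ = floor≡/ℕ (ℚ.1ℚ ℚ.- α) (toℚᵘ[1-α] α≃P/Q)
  Q-P≡t+fQ : + Q - P ≡ + t + f * + Q
  Q-P≡t+fQ = trans (a≡a%ℕn+[a/ℕn]*n (+ Q - P) Q) (cong (λ g → + t + g * + Q) (sym f≡))
  ring₁ : ∀ x p k q f → x * q - (p + k * q) - f * q ≡ (x - k - 1ℤ) * q + (q - p - f * q)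
  ring₁ = solve-∀
  ring₂ : ∀ a t b → a + (t + b - b) ≡ a + t
  ring₂ = solve-∀
  numerator≡ : X * + Q - (P + + k * + Q) - f * + Q ≡ (X - + k - 1ℤ) * + Q + + t
  numerator≡ = begin
    X * + Q - (P + + k * + Q) - f * + Q               ≡⟨ ring₁ X P (+ k) (+ Q) f ⟩
    (X - + k - 1ℤ) * + Q + (+ Q - P - f * + Q)        ≡⟨ cong (λ a → (X - + k - 1ℤ) * + Q + (a - f * + Q)) Q-P≡t+fQ ⟩
    (X - + k - 1ℤ) * + Q + (+ t + f * + Q - f * + Q)  ≡⟨ ring₂ ((X - + k - 1ℤ) * + Q) (+ t) (f * + Q) ⟩
    (X - + k - 1ℤ) * + Q + + t                        ∎

floor-γ-reflection-at : ∀ {α α′ y y′ P Q X} M k k′ .{{_ : ℕ.NonZero Q}} .{{_ : ℕ.NonZero M}} .{{_ : ℕ.NonZero (M ℕ.* Q)}} →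
                        toℚᵘ α ℚᵘ.≃ P ℚᵘ./ Q → toℚᵘ α′ ℚᵘ.≃ (+ Q - P) ℚᵘ./ Q →
                        D M α ≡ candidate M α k → D M α′ ≡ candidate M α′ k′ → suc (k ℕ.+ k′) ≡ M →
                        toℚᵘ y ℚᵘ.≃ X ℚᵘ./ M → toℚᵘ y′ ℚᵘ.≃ (- X) ℚᵘ./ M →
                        floor (y′ ℚ.- γ M α) + 1ℤ ≡ - (floor (y ℚ.- γ M α′) + 1ℤ)
floor-γ-reflection-at {α} {α′} {y} {y′} {P} {Q} {X} M k k′ α≃P/Q α′≃[Q-P]/Q Dα≡ Dα′≡ 1+k+k′≡M y≃X/M y′≃-X/M = begin
  floor (y′ ℚ.- γ M α) + 1ℤ          ≡⟨ cong (_+ 1ℤ) (floor[y-γ] M k α≃P/Q Dα≡ y′≃-X/M) ⟩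
  (- X - + k - 1ℤ) /ℕ M + 1ℤ        ≡⟨ cong (λ a → a /ℕ M + 1ℤ) (ring₁ X (+ k)) ⟩
  (-1ℤ - (X + + k)) /ℕ M + 1ℤ       ≡⟨ cong (_+ 1ℤ) ([-1-a]/ℕd≡-1-a/ℕd M (X + + k)) ⟩
  -1ℤ - (X + + k) /ℕ M + 1ℤ         ≡⟨ ring₂ ((X + + k) /ℕ M) ⟩
  - ((X + + k) /ℕ M - 1ℤ + 1ℤ)      ≡⟨ cong (λ a → - (a + 1ℤ)) ([a-d]/ℕd≡a/ℕd-1 M (X + + k)) ⟨
  - ((X + + k - + M) /ℕ M + 1ℤ)     ≡⟨ cong (λ a → - (a /ℕ M + 1ℤ)) X+k-M≡X-k′-1 ⟩
  - ((X - + k′ - 1ℤ) /ℕ M + 1ℤ)     ≡⟨ cong (λ a → - (a + 1ℤ)) (floor[y-γ] M k′ α′≃[Q-P]/Q Dα′≡ y≃X/M) ⟨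
  - (floor (y ℚ.- γ M α′) + 1ℤ)     ∎
  where
  open ≡-Reasoning
  ring₁ : ∀ x k → - x - k - 1ℤ ≡ -1ℤ - (x + k)
  ring₁ = solve-∀
  ring₂ : ∀ a → -1ℤ - a + 1ℤ ≡ - (a - 1ℤ + 1ℤ)
  ring₂ = solve-∀
  ring₃ : ∀ x k k′ → x + k - (1ℤ + (k + k′)) ≡ x - k′ - 1ℤ
  ring₃ = solve-∀
  X+k-M≡X-k′-1 : X + + k - + M ≡ X - + k′ - 1ℤ
  X+k-M≡X-k′-1 = begin
    X + + k - + M                    ≡⟨ cong (λ m → X + + k - + m) 1+k+k′≡M ⟨
    X + + k - + suc (k ℕ.+ k′)       ≡⟨ cong (λ a → X + + k - (1ℤ + a)) (ℤ.pos-+ k k′) ⟩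
    X + + k - (1ℤ + (+ k + + k′))    ≡⟨ ring₃ X (+ k) (+ k′) ⟩
    X - + k′ - 1ℤ                    ∎

floor-γ-reflection : ∀ {α α′ y y′ P Q X} M .{{_ : ℕ.NonZero Q}} .{{_ : ℕ.NonZero M}} .{{_ : ℕ.NonZero (M ℕ.* Q)}} →
                     toℚᵘ α ℚᵘ.≃ P ℚᵘ./ Q → toℚᵘ α′ ℚᵘ.≃ (+ Q - P) ℚᵘ./ Q → Coprime Q M →
                     toℚᵘ y ℚᵘ.≃ X ℚᵘ./ M → toℚᵘ y′ ℚᵘ.≃ (- X) ℚᵘ./ M →
                     floor (y′ ℚ.- γ M α) + 1ℤ ≡ - (floor (y ℚ.- γ M α′) + 1ℤ)
floor-γ-reflection {P = P} {Q} M α≃P/Q α′≃[Q-P]/Q Q⊥M y≃X/M y′≃-X/M =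
  let k , k<M , M∣P+kQ , Dα≡ = D≡candidate M α≃P/Q Q⊥M
      k′ , k′<M , M∣Q-P+k′Q , Dα′≡ = D≡candidate M α′≃[Q-P]/Q Q⊥M
      1+k+k′≡M = M∣P+kQ∧M∣Q-P+k′Q⇒1+k+k′≡M {P} {Q} {M} {k} {k′} k<M k′<M Q⊥M M∣P+kQ M∣Q-P+k′Q
  in floor-γ-reflection-at M k k′ α≃P/Q α′≃[Q-P]/Q Dα≡ Dα′≡ 1+k+k′≡M y≃X/M y′≃-X/M

-- The common divisor c and the two sides of the identity

∣∣i∣∧∣∣j∣⇒∣∣i-j∣ : ∀ {g} i j → g ℕ.∣ ∣ i ∣ → g ℕ.∣ ∣ j ∣ → g ℕ.∣ ∣ i - j ∣
∣∣i∣∧∣∣j∣⇒∣∣i-j∣ {g} i j g∣i g∣j = ∣⇒∣ᵤ (ℤ.∣m∣n⇒∣m-n {+ g} {i} {j} (∣ᵤ⇒∣ g∣i) (∣ᵤ⇒∣ g∣j))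

gcd[∣i-j∣,∣j∣]≡gcd[∣i∣,∣j∣] : ∀ i j → gcd (∣ i - j ∣) (∣ j ∣) ≡ gcd (∣ i ∣) (∣ j ∣)
gcd[∣i-j∣,∣j∣]≡gcd[∣i∣,∣j∣] i j = ℕ.∣-antisym
  (gcd-greatest g′∣i g′∣j)
  (gcd-greatest (∣∣i∣∧∣∣j∣⇒∣∣i-j∣ i j g∣i g∣j) g∣j)
  where
  g  = gcd (∣ i ∣) (∣ j ∣)
  g′ = gcd (∣ i - j ∣) (∣ j ∣)
  g∣i = gcd[m,n]∣m (∣ i ∣) (∣ j ∣)
  g∣j = gcd[m,n]∣n (∣ i ∣) (∣ j ∣)
  g′∣j = gcd[m,n]∣n (∣ i - j ∣) (∣ j ∣)
  ring : ∀ i j → i - j - - j ≡ i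
  ring = solve-∀
  g′∣i : g′ ℕ.∣ ∣ i ∣
  g′∣i = subst (λ a → g′ ℕ.∣ ∣ a ∣) (ring i j)
    (∣∣i∣∧∣∣j∣⇒∣∣i-j∣ (i - j) (- j) (gcd[m,n]∣m (∣ i - j ∣) (∣ j ∣))
                                    (subst (g′ ℕ.∣_) (sym (ℤ.∣-i∣≡∣i∣ j)) g′∣j))

cOf-reflect : ∀ r s b → cOf (r - s) (- s) b ≡ cOf r s b
cOf-reflect r s b = cong (λ g → gcd g b) (begin
  gcd (∣ r - s ∣) (∣ - s ∣)  ≡⟨ cong (gcd (∣ r - s ∣)) (ℤ.∣-i∣≡∣i∣ s) ⟩
  gcd (∣ r - s ∣) (∣ s ∣)    ≡⟨ gcd[∣i-j∣,∣j∣]≡gcd[∣i∣,∣j∣] r s ⟩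
  gcd (∣ r ∣) (∣ s ∣)        ∎)
  where open ≡-Reasoning

cOf∣b : ∀ r s b → cOf r s b ℕ.∣ b
cOf∣b r s b = gcd[m,n]∣n (gcd (∣ r ∣) (∣ s ∣)) b

cOf∣r : ∀ r s b → cOf r s b ℕ.∣ ∣ r ∣
cOf∣r r s b = ℕ.∣-trans (gcd[m,n]∣m (gcd (∣ r ∣) (∣ s ∣)) b) (gcd[m,n]∣m (∣ r ∣) (∣ s ∣))

cOf∣s : ∀ r s b → cOf r s b ℕ.∣ ∣ s ∣
cOf∣s r s b = ℕ.∣-trans (gcd[m,n]∣m (gcd (∣ r ∣) (∣ s ∣)) b) (gcd[m,n]∣n (∣ r ∣) (∣ s ∣))

m≡divℕ[m,c]*c : ∀ {m c} .{{_ : ℕ.NonZero c}} → c ℕ.∣ m → m ≡ divℕ m c ℕ.* c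
m≡divℕ[m,c]*c {c = suc _} c∣m = sym (ℕ.m/n*n≡m c∣m)

frac-≃ : ∀ r s {c Q} .{{_ : ℕ.NonZero c}} .{{_ : ℕ.NonZero Q}} → ∣ s ∣ ≡ Q ℕ.* c → c ℕ.∣ ∣ r ∣ →
         ∃[ P ] toℚᵘ (frac r s) ℚᵘ.≃ P ℚᵘ./ Q × toℚᵘ (frac (r - s) (- s)) ℚᵘ.≃ (+ Q - P) ℚᵘ./ Q
frac-≃ r (+ zero) {c} {Q} 0≡Qc _ = ⊥-elim (ℕ.≢-nonZero⁻¹ (Q ℕ.* c) {{ℕ.m*n≢0 Q c}} (sym 0≡Qc))
frac-≃ r (+ suc S-1) {c} {Q} ∣s∣≡Qc c∣r =
  let ℤ.divides P r≡Pc = ∣ᵤ⇒∣ {+ c} {r} c∣r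
      S = suc S-1
      S≡Qc : + S ≡ + Q * + c
      S≡Qc = trans (cong +_ ∣s∣≡Qc) (ℤ.pos-* Q c)
  in P
  , ≃-rescale (toℚᵘ-frac r S) (begin
      r * + Q              ≡⟨ cong (_* + Q) r≡Pc ⟩
      P * + c * + Q        ≡⟨ ring₁ P (+ c) (+ Q) ⟩
      P * (+ Q * + c)      ≡⟨ cong (P *_) S≡Qc ⟨
      P * + S              ∎)
  , ≃-rescale (toℚᵘ-frac (- (r - + S)) S) (begin
      - (r - + S) * + Q                ≡⟨ cong₂ (λ a b → - (a - b) * + Q) r≡Pc S≡Qc ⟩
      - (P * + c - + Q * + c) * + Q    ≡⟨ ring₂ P (+ c) (+ Q) ⟩
      (+ Q - P) * (+ Q * + c)          ≡⟨ cong ((+ Q - P) *_) S≡Qc ⟨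
      (+ Q - P) * + S                  ∎)
  where
  open ≡-Reasoning
  ring₁ : ∀ p c q → p * c * q ≡ p * (q * c)
  ring₁ = solve-∀
  ring₂ : ∀ p c q → - (p * c - q * c) * q ≡ (q - p) * (q * c)
  ring₂ = solve-∀
frac-≃ r -[1+ S-1 ] {c} {Q} ∣s∣≡Qc c∣r =
  let ℤ.divides P r≡Pc = ∣ᵤ⇒∣ {+ c} {r} c∣r
      S = suc S-1
      S≡Qc : + S ≡ + Q * + c
      S≡Qc = trans (cong +_ ∣s∣≡Qc) (ℤ.pos-* Q c)
  in - P
  , ≃-rescale (toℚᵘ-frac (- r) S) (begin
      - r * + Q            ≡⟨ cong (λ a → - a * + Q) r≡Pc ⟩
      - (P * + c) * + Q    ≡⟨ ring₁ P (+ c) (+ Q) ⟩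
      - P * (+ Q * + c)    ≡⟨ cong ((- P) *_) S≡Qc ⟨
      - P * + S            ∎)
  , ≃-rescale (toℚᵘ-frac (r - - + S) S) (begin
      (r - - + S) * + Q                ≡⟨ cong₂ (λ a b → (a - - b) * + Q) r≡Pc S≡Qc ⟩
      (P * + c - - (+ Q * + c)) * + Q  ≡⟨ ring₂ P (+ c) (+ Q) ⟩
      (+ Q - - P) * (+ Q * + c)        ≡⟨ cong ((+ Q - - P) *_) S≡Qc ⟨
      (+ Q - - P) * + S                ∎)
  where
  open ≡-Reasoning
  ring₁ : ∀ p c q → - (p * c) * q ≡ - p * (q * c)
  ring₁ = solve-∀
  ring₂ : ∀ p c q → (p * c - - (q * c)) * q ≡ (q - - p) * (q * c)
  ring₂ = solve-∀

δ-coprime : ∀ b r s {c} x → cOf r s b ≡ c → Coprime (divℕ ∣ s ∣ c) (divℕ b c) →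
            δ b r s x ≡ floor (frac (+ c) (+ 1) ℚ.* x ℚ.- γ (divℕ b c) (frac r s)) + 1ℤ
δ-coprime b r s x refl cop with coprime? (divℕ ∣ s ∣ (cOf r s b)) (divℕ b (cOf r s b))
... | yes _    = refl
... | no ¬cop = ⊥-elim (¬cop cop)

δ-¬coprime : ∀ b r s {c} x → cOf r s b ≡ c → ¬ Coprime (divℕ ∣ s ∣ c) (divℕ b c) → δ b r s x ≡ 0ℤ
δ-¬coprime b r s x refl ¬cop with coprime? (divℕ ∣ s ∣ (cOf r s b)) (divℕ b (cOf r s b))
... | yes cop = ⊥-elim (¬cop cop)
... | no _     = refl

coprime-branch-reflection : ∀ r s n {b c} .{{_ : ℕ.NonZero b}} → s ≢ 0ℤ →
  c ℕ.∣ b → c ℕ.∣ ∣ r ∣ → c ℕ.∣ ∣ s ∣ → Coprime (divℕ ∣ s ∣ c) (divℕ b c) →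
  floor (frac (+ c) (+ 1) ℚ.* ℚ.- frac n (+ b) ℚ.- γ (divℕ b c) (frac r s)) + 1ℤ
    ≡ - (floor (frac (+ c) (+ 1) ℚ.* frac n (+ b) ℚ.- γ (divℕ b c) (frac (r - s) (- s))) + 1ℤ)
coprime-branch-reflection r s n {b} {c} s≢0 c∣b c∣r c∣s Q⊥M =
  let P , α≃P/Q , α′≃[Q-P]/Q = frac-≃ r s {{c≢0}} {{Q≢0}} ∣s∣≡Qc c∣r
  in floor-γ-reflection M α≃P/Q α′≃[Q-P]/Q Q⊥M
       (toℚᵘ-c*x b≡Mc (toℚᵘ-frac n b)) (toℚᵘ-c*x b≡Mc (toℚᵘ-neg-frac n b))
  where
  M = divℕ b c
  Q = divℕ ∣ s ∣ c
  instance
    c≢0 : ℕ.NonZero c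
    c≢0 = ℕ.≢-nonZero (λ { refl → ℕ.≢-nonZero⁻¹ b (ℕ.0∣⇒≡0 c∣b) })
  b≡Mc : b ≡ M ℕ.* c
  b≡Mc = m≡divℕ[m,c]*c c∣b
  ∣s∣≡Qc : ∣ s ∣ ≡ Q ℕ.* c
  ∣s∣≡Qc = m≡divℕ[m,c]*c c∣s
  instance
    M≢0 : ℕ.NonZero M
    M≢0 = ℕ.≢-nonZero (λ M≡0 → ℕ.≢-nonZero⁻¹ b (trans b≡Mc (cong (ℕ._* c) M≡0)))
    Q≢0 : ℕ.NonZero Q
    Q≢0 = ℕ.≢-nonZero (λ Q≡0 → s≢0 (ℤ.∣i∣≡0⇒i≡0 (trans ∣s∣≡Qc (cong (ℕ._* c) Q≡0))))
    MQ≢0 : ℕ.NonZero (M ℕ.* Q)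
    MQ≢0 = ℕ.m*n≢0 M Q

lemma3p9 : (r s n : ℤ) (b : ℕ) → s ≢ + 0 → 1 ≤ b →
    δ b r s (Data.Rational.-_ (frac n (+ b))) ≡ - δ b (r - s) (- s) (frac n (+ b))
lemma3p9 r s n b@(suc _) s≢0 _ = case coprime? (divℕ ∣ s ∣ c) M of λ where
    (no ¬cop) → begin
      δ b r s (ℚ.- x)          ≡⟨ δ-¬coprime b r s (ℚ.- x) refl ¬cop ⟩
      0ℤ                       ≡⟨ cong -_ (δ-¬coprime b (r - s) (- s) x (cOf-reflect r s b) (¬cop ∘ ∣-s∣→∣s∣)) ⟨
      - δ b (r - s) (- s) x    ∎
    (yes cop) → begin
      δ b r s (ℚ.- x)                                                        ≡⟨ δ-coprime b r s (ℚ.- x) refl cop ⟩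
      floor (frac (+ c) (+ 1) ℚ.* ℚ.- x ℚ.- γ M (frac r s)) + 1ℤ             ≡⟨ coprime-branch-reflection r s n s≢0
                                                                                 (cOf∣b r s b) (cOf∣r r s b) (cOf∣s r s b) cop ⟩
      - (floor (frac (+ c) (+ 1) ℚ.* x ℚ.- γ M (frac (r - s) (- s))) + 1ℤ)  ≡⟨ cong -_ (δ-coprime b (r - s) (- s) x
                                                                                   (cOf-reflect r s b) (∣s∣→∣-s∣ cop)) ⟨
      - δ b (r - s) (- s) x                                                  ∎
  where
  open ≡-Reasoning
  c = cOf r s b
  M = divℕ b c
  x = frac n (+ b)
  ∣s∣→∣-s∣ : Coprime (divℕ ∣ s ∣ c) M → Coprime (divℕ ∣ - s ∣ c) M
  ∣s∣→∣-s∣ = subst (λ a → Coprime (divℕ a c) M) (sym (ℤ.∣-i∣≡∣i∣ s))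
  ∣-s∣→∣s∣ : Coprime (divℕ ∣ - s ∣ c) M → Coprime (divℕ ∣ s ∣ c) M
  ∣-s∣→∣s∣ = subst (λ a → Coprime (divℕ a c) M) (ℤ.∣-i∣≡∣i∣ s)
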